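{- There is an algorithm which, given a morphism $\phi$ on $\Sigma=\{0,\dots,\sigma-1\}$ prolongable on a letter $a$ (i.e. $\phi(a)=as$ with $s$ nonempty), decides whether the Parikh vectors of the returns to the first letter $a$ in the infinite word $w=\lim_n\phi^n(a)$ generate $\mathbb{Z}^\sigma$ as an additive group.
   Context: Morphisms are nonerasing. The Parikh vector of a finite word $u$ is $V_u=(|u|_0,\dots,|u|_{\sigma-1})$. If $a_0<a_1<\dots$ are the positions of occurrences of a factor $u$ in $w$, a return to $u$ is a factor $w[a_i,a_{i+1})$. -}

module Defs where

open import Data.Nat using (ℕ; zero; suc; _<_)
open import Data.Fin using (Fin; _≟_)
open import Data.Bool using (true; false)
open import Data.List using (List; []; _∷_; length; concatMap)
open import Data.Integer using (ℤ; +_; _+_; -_)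
open import Data.Product using (∃; _×_; Σ)
open import Relation.Nullary using (¬_; does)
open import Relation.Binary.PropositionalEquality using (_≡_)

Morphism : ℕ → Set
Morphism σ = Fin σ → List (Fin σ)

Nonerasing : ∀ {σ} → Morphism σ → Set
Nonerasing {σ} φ = (c : Fin σ) → 0 < length (φ c)

Prolongable : ∀ {σ} → Morphism σ → Fin σ → Set
Prolongable {σ} φ a = Σ (List (Fin σ)) λ s → ¬ (s ≡ []) × (φ a ≡ a ∷ s)

apply : ∀ {σ} → Morphism σ → List (Fin σ) → List (Fin σ)
apply φ = concatMap φ

iter : ∀ {σ} → Morphism σ → ℕ → Fin σ → List (Fin σ)
iter φ zero    a = a ∷ []
iter φ (suc k) a = apply φ (iter φ k a)

nth : ∀ {A : Set} → A → List A → ℕ → A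
nth d []       _       = d
nth d (x ∷ xs) zero    = x
nth d (x ∷ xs) (suc n) = nth d xs n

-- The infinite word w = lim φ^n(a): its n-th letter is the n-th letter of φ^n(a)
-- (when φ is nonerasing and prolongable on a, |φ^n(a)| ≥ n+1 and φ^n(a) is a
-- prefix of w, so the default value is never used).
fixpt : ∀ {σ} → Morphism σ → Fin σ → ℕ → Fin σ
fixpt φ a n = nth a (iter φ n a) n

countIn : ∀ {σ} → (ℕ → Fin σ) → Fin σ → ℕ → ℕ → ℕ
countIn w c i zero      = 0
countIn w c i (suc len) with does (w i ≟ c)
... | true  = suc (countIn w c (suc i) len)
... | false = countIn w c (suc i) len

parikh : ∀ {σ} → (ℕ → Fin σ) → ℕ → ℕ → Fin σ → ℤ
parikh w i len c = + countIn w c i len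

IsReturnParikh : ∀ {σ} → (ℕ → Fin σ) → Fin σ → (Fin σ → ℤ) → Set
IsReturnParikh {σ} w a v =
  ∃ λ i → ∃ λ len →
    (0 < len) × (w i ≡ a) × (w (i Data.Nat.+ len) ≡ a) ×
    ((k : ℕ) → 0 < k → k < len → ¬ (w (i Data.Nat.+ k) ≡ a)) ×
    ((c : Fin σ) → v c ≡ parikh w i len c)

-- The additive subgroup of ℤ^σ generated by a set P of vectors (vectors are
-- functions Fin σ → ℤ, considered up to pointwise equality).
data Span {σ : ℕ} (P : (Fin σ → ℤ) → Set) : (Fin σ → ℤ) → Set where
  gen  : ∀ {v} → P v → Span P v
  zer  : Span P (λ _ → + 0)
  add  : ∀ {u v} → Span P u → Span P v → Span P (λ c → u c + v c)
  neg  : ∀ {u} → Span P u → Span P (λ c → - u c)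
  ext  : ∀ {u v} → Span P u → ((c : Fin σ) → u c ≡ v c) → Span P v

GeneratesAll : ∀ {σ} → ((Fin σ → ℤ) → Set) → Set
GeneratesAll {σ} P = (v : Fin σ → ℤ) → Span P v

{-# OPTIONS --safe #-}
module Submission where

-- Consecutive returns to a telescope, so their Parikh vectors generate the same subgroup Γ of
-- ℤ^σ as the Parikh vectors of the prefixes w[0,j) with w_j = a.
-- If Γ = ℤ^σ, every unit vector e_c is congruent modulo 2 to some g_c ∈ Γ. The matrix of the g_c
-- is then ≡ I (mod 2), and Gauss–Jordan elimination with odd pivots turns it into a diagonal
-- matrix with odd diagonal entries, whose product D ≠ 0 satisfies Dℤ^σ ⊆ Γ. Then Γ = ℤ^σ iff
-- every e_c is congruent modulo |D| to an element of Γ.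
-- Congruence modulo m to an element of Γ is decidable: φ maps w[0,k) onto the prefix
-- w[0,|φ(w[0,k))|), and the Parikh vector of φ(u) is the incidence matrix of φ applied to that
-- of u, so the pairs (Parikh vector of w[0,j) mod m, w_j) are the states reachable in a finite
-- automaton; the residues at occurrences of a generate the image of Γ in (ℤ/m)^σ.

open import Algebra.Bundles using (Semiring)
import Algebra.Properties.CommutativeMonoid.Sum as CommutativeMonoidSum
import Algebra.Properties.Semiring.Sum as SemiringSum
open import Data.Bool using (true; false; if_then_else_)
open import Data.Empty using (⊥-elim)
open import Data.Fin as Fin using (Fin; zero; suc)
import Data.Fin.Properties as Finₚ
open import Data.Integer using (ℤ; +_; -[1+_]; ∣_∣)
open import Data.Integer.Divisibility.Signed
  using (_∣_; divides; _∣?_; ∣-refl; m∣∣m∣; ∣m∣n⇒∣m+n; ∣m⇒∣-m; ∣m⇒∣m*n; ∣n⇒∣m*n; ∣⇒∣ᵤ)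
import Data.Integer.Properties as ℤₚ
open import Data.Integer.Tactic.RingSolver using (solve-∀)
open import Data.List
  using (List; []; _∷_; [_]; _++_; length; filter; take; map; concatMap; upTo; allFin; cartesianProduct)
open import Data.List.Membership.Propositional using (_∈_; _∉_; find; lose)
open import Data.List.Membership.Propositional.Properties
  using ( ∈-allFin; ∈-filter⁺; ∈-map⁺; ∈-map⁻; ∈-concatMap⁺; ∈-upTo⁺; ∈-upTo⁻
        ; ∈-map∘filter⁺; ∈-map∘filter⁻; ∈-cartesianProduct⁺)
open import Data.List.Properties
  using (length-++; length-++-≤ˡ; filter-++; filter-notAll; ++-identityʳ; ++-assoc; concatMap-++)
open import Data.List.Relation.Unary.Any as Any using (here; there; any?)
open import Data.Nat as ℕ using (ℕ; zero; suc; NonZero; ≢-nonZero; _≤_; _<_; z≤n; s≤s)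
import Data.Nat.Divisibility as ℕ∣
open import Data.Nat.DivMod using (m≡m%n+[m/n]*n; %-distribˡ-+; %-distribˡ-*; m%n%n≡m%n; m%n<n)
import Data.Nat.Properties as ℕₚ
open import Data.Product using (Σ; ∃; ∃₂; _×_; _,_; proj₁; proj₂)
import Data.Product.Properties as Productₚ
open import Data.Sum using (_⊎_; inj₁; inj₂)
open import Data.Vec using (Vec; []; _∷_; lookup; tabulate)
open import Data.Vec.Properties using (lookup∘tabulate; tabulate-cong)
import Data.Vec.Properties as Vecₚ
open import Relation.Binary.Definitions using (DecidableEquality)
open import Relation.Binary.PropositionalEquality
  using (_≡_; _≢_; refl; sym; trans; cong; cong₂; subst; subst₂; module ≡-Reasoning)
open import Relation.Nullary using (Dec; yes; no; does; ¬?)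
import Relation.Nullary.Decidable as Dec

open import Defs

module Kronecker {c ℓ} (R : Semiring c ℓ) where

  open Semiring R
    using (Carrier; _≈_; _+_; _*_; 0#; 1#; setoid; +-cong; +-congˡ; +-identityˡ; +-identityʳ
          ; *-identityˡ; *-identityʳ; zeroˡ; zeroʳ)
  open SemiringSum R using (sum; sum-cong-≋; sum-replicate-zero)
  open import Relation.Binary.Reasoning.Setoid setoid

  δ : ∀ {n} → Fin n → Fin n → Carrier
  δ i j = if does (i Fin.≟ j) then 1# else 0#

  δ-diag : ∀ {n} (i : Fin n) → δ i i ≡ 1#
  δ-diag i with i Fin.≟ i
  ... | yes _  = refl
  ... | no i≢i = ⊥-elim (i≢i refl)

  δ-off : ∀ {n} {i j : Fin n} → i ≢ j → δ i j ≡ 0#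
  δ-off {i = i} {j} i≢j with i Fin.≟ j
  ... | yes i≡j = ⊥-elim (i≢j i≡j)
  ... | no _    = refl

  sum-*δ : ∀ {n} (f : Fin n → Carrier) j → sum (λ i → f i * δ i j) ≈ f j
  sum-*δ {suc n} f zero = begin
    f zero * 1# + sum (λ i → f (suc i) * 0#) ≈⟨ +-cong (*-identityʳ _) (sum-cong-≋ {n} (λ _ → zeroʳ _)) ⟩
    f zero + sum {n} (λ _ → 0#)               ≈⟨ +-congˡ (sum-replicate-zero n) ⟩
    f zero + 0#                               ≈⟨ +-identityʳ _ ⟩
    f zero                                    ∎
  sum-*δ {suc n} f (suc j) = begin
    f zero * 0# + sum (λ i → f (suc i) * δ i j) ≈⟨ +-cong (zeroʳ _) (sum-*δ (λ i → f (suc i)) j) ⟩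
    0# + f (suc j)                              ≈⟨ +-identityˡ _ ⟩
    f (suc j)                                   ∎

  sum-δ* : ∀ {n} i (f : Fin n → Carrier) → sum (λ j → δ i j * f j) ≈ f i
  sum-δ* {suc n} zero f = begin
    1# * f zero + sum (λ j → 0# * f (suc j)) ≈⟨ +-cong (*-identityˡ _) (sum-cong-≋ {n} (λ _ → zeroˡ _)) ⟩
    f zero + sum {n} (λ _ → 0#)               ≈⟨ +-congˡ (sum-replicate-zero n) ⟩
    f zero + 0#                               ≈⟨ +-identityʳ _ ⟩
    f zero                                    ∎
  sum-δ* {suc n} (suc i) f = begin
    0# * f zero + sum (λ j → δ i j * f (suc j)) ≈⟨ +-cong (zeroˡ _) (sum-δ* i (λ j → f (suc j))) ⟩
    0# + f (suc i)                              ≈⟨ +-identityˡ _ ⟩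
    f (suc i)                                   ∎

-- Reachability in a finite graph

module Reachability {S : Set} (_≟_ : DecidableEquality S) (states : List S)
                    (start : S) (next : S → List S)
                    (next⊆states : ∀ s {t} → t ∈ next s → t ∈ states) where

  open import Data.List.Membership.DecPropositional _≟_ using (_∈?_)
  open ℕₚ using (≤-refl; ≤-trans; ≤-pred; n≮0)

  data Reach : S → Set where
    start-reach : Reach start
    step        : ∀ {s t} → Reach s → t ∈ next s → Reach t

  private

    Closed : List S → Set
    Closed L = ∀ {s t} → s ∈ L → t ∈ next s → t ∈ L

    closed-or-escape : ∀ L → Closed L ⊎ ∃₂ λ s t → s ∈ L × t ∈ next s × t ∉ L
    closed-or-escape L with any? (λ s → any? (λ t → ¬? (t ∈? L)) (next s)) L
    ... | yes escape = let s , s∈L , out = find escape ; t , t∈next , t∉L = find out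
                       in inj₂ (s , t , s∈L , t∈next , t∉L)
    ... | no ¬escape = inj₁ closed
      where
      closed : Closed L
      closed {s} {t} s∈L t∈next with t ∈? L
      ... | yes t∈L = t∈L
      ... | no  t∉L = ⊥-elim (¬escape (lose s∈L (lose t∈next t∉L)))

    ReachableSet : Set
    ReachableSet = Σ (List S) λ L → (∀ {s} → s ∈ L → Reach s) × (∀ {s} → Reach s → s ∈ L)

    explore : ∀ n L U → length U ≤ n →
              (∀ {s} → s ∈ L → Reach s) → start ∈ L →
              (∀ {s} → s ∈ states → s ∈ L ⊎ s ∈ U) → ReachableSet
    explore n L U |U|≤n sound start∈L cover with closed-or-escape L
    ... | inj₁ closed = L , sound , complete
      where
      complete : ∀ {s} → Reach s → s ∈ L
      complete start-reach     = start∈L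
      complete (step r t∈next) = closed (complete r) t∈next
    ... | inj₂ (s , t , s∈L , t∈next , t∉L) with cover (next⊆states s t∈next)
    ...   | inj₁ t∈L = ⊥-elim (t∉L t∈L)
    ...   | inj₂ t∈U = continue n |U|≤n
      where
      U′ : List S
      U′ = filter (λ x → ¬? (x ≟ t)) U

      shrink : length U′ < length U
      shrink = filter-notAll _ U (Any.map (λ t≡x x≢t → x≢t (sym t≡x)) t∈U)

      sound′ : ∀ {x} → x ∈ t ∷ L → Reach x
      sound′ (here refl) = step (sound s∈L) t∈next
      sound′ (there x∈L) = sound x∈L

      cover′ : ∀ {x} → x ∈ states → x ∈ t ∷ L ⊎ x ∈ U′
      cover′ {x} x∈states with cover x∈states
      ... | inj₁ x∈L = inj₁ (there x∈L)
      ... | inj₂ x∈U with x ≟ t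
      ...   | yes refl = inj₁ (here refl)
      ...   | no  x≢t  = inj₂ (∈-filter⁺ _ x∈U x≢t)

      continue : ∀ n → length U ≤ n → ReachableSet
      continue zero    |U|≤0   = ⊥-elim (n≮0 (≤-trans shrink |U|≤0))
      continue (suc n) |U|≤1+n = explore n (t ∷ L) U′ (≤-pred (≤-trans shrink |U|≤1+n))
                                   sound′ (there start∈L) cover′

    exploration : ReachableSet
    exploration = explore (length states) (start ∷ []) states ≤-refl
                    (λ { (here refl) → start-reach }) (here refl) inj₂

  reachable : List S
  reachable = proj₁ exploration

  ∈reachable⇒Reach : ∀ {s} → s ∈ reachable → Reach s
  ∈reachable⇒Reach = proj₁ (proj₂ exploration)

  Reach⇒∈reachable : ∀ {s} → Reach s → s ∈ reachable
  Reach⇒∈reachable = proj₂ (proj₂ exploration)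

-- Words and Parikh vectors

module _ where

  open import Data.Nat using (_+_; _*_; _∸_; _%_)
  open ℕₚ hiding (_≟_)
  open Kronecker ℕₚ.+-*-semiring using (δ; sum-δ*)
  open SemiringSum ℕₚ.+-*-semiring using (sum; sum-cong-≗; sum-replicate-zero; ∑-distrib-+)

  module _ {A : Set} where

    factor : (ℕ → A) → ℕ → ℕ → List A
    factor w i zero      = []
    factor w i (suc len) = w i ∷ factor w (suc i) len

    prefix : (ℕ → A) → ℕ → List A
    prefix w = factor w 0

    length-factor : ∀ w i len → length (factor w i len) ≡ len
    length-factor w i zero      = refl
    length-factor w i (suc len) = cong suc (length-factor w (suc i) len)

    factor-+ : ∀ w i l₁ l₂ → factor w i (l₁ + l₂) ≡ factor w i l₁ ++ factor w (i + l₁) l₂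
    factor-+ w i zero     l₂ = cong (λ j → factor w j l₂) (sym (+-identityʳ i))
    factor-+ w i (suc l₁) l₂ = cong (w i ∷_) (trans (factor-+ w (suc i) l₁ l₂)
      (cong (λ j → factor w (suc i) l₁ ++ factor w j l₂) (sym (+-suc i l₁))))

    factor-snoc : ∀ w i l → factor w i (suc l) ≡ factor w i l ++ [ w (i + l) ]
    factor-snoc w i l = trans (cong (factor w i) (+-comm 1 l)) (factor-+ w i l 1)

    nth-++ˡ : ∀ (d : A) xs ys {k} → k < length xs → nth d (xs ++ ys) k ≡ nth d xs k
    nth-++ˡ d (x ∷ xs) ys {zero}  _        = refl
    nth-++ˡ d (x ∷ xs) ys {suc k} (s≤s k<) = nth-++ˡ d xs ys k<

    nth-++ʳ : ∀ (d : A) xs ys k → nth d (xs ++ ys) (length xs + k) ≡ nth d ys k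
    nth-++ʳ d []       ys k = refl
    nth-++ʳ d (x ∷ xs) ys k = nth-++ʳ d xs ys k

    nth-factor : ∀ (d : A) w i {len k} → k < len → nth d (factor w i len) k ≡ w (i + k)
    nth-factor d w i {suc len} {zero}  _        = cong w (sym (+-identityʳ i))
    nth-factor d w i {suc len} {suc k} (s≤s k<) = trans (nth-factor d w (suc i) k<) (cong w (sym (+-suc i k)))

    ≡factor : ∀ (d : A) w i xs → (∀ k → k < length xs → nth d xs k ≡ w (i + k)) →
              xs ≡ factor w i (length xs)
    ≡factor d w i []       _     = refl
    ≡factor d w i (x ∷ xs) agree = cong₂ _∷_
      (trans (agree 0 (s≤s z≤n)) (cong w (+-identityʳ i)))
      (≡factor d w (suc i) xs (λ k k< → trans (agree (suc k) (s≤s k<)) (cong w (+-suc i k))))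

    ++≡factor⇒≡factor : ∀ (d : A) w i {n} xs ys → xs ++ ys ≡ factor w i n → xs ≡ factor w i (length xs)
    ++≡factor⇒≡factor d w i {n} xs ys eq = ≡factor d w i xs λ k k< → begin
      nth d xs k              ≡⟨ sym (nth-++ˡ d xs ys k<) ⟩
      nth d (xs ++ ys) k      ≡⟨ cong (λ zs → nth d zs k) eq ⟩
      nth d (factor w i n) k  ≡⟨ nth-factor d w i (<-≤-trans k< |xs|≤n) ⟩
      w (i + k)               ∎
      where
      open ≡-Reasoning
      |xs|≤n : length xs ≤ n
      |xs|≤n = subst (length xs ≤_) (trans (cong length eq) (length-factor w i n)) (length-++-≤ˡ xs)

    take-factor : ∀ w i {l n} → l ≤ n → take l (factor w i n) ≡ factor w i l
    take-factor w i {zero}          _         = refl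
    take-factor w i {suc l} {suc n} (s≤s l≤n) = cong (w i ∷_) (take-factor w (suc i) l≤n)

    take-++ʳ : ∀ (xs ys : List A) r → take (length xs + r) (xs ++ ys) ≡ xs ++ take r ys
    take-++ʳ []       ys r = refl
    take-++ʳ (x ∷ xs) ys r = cong (x ∷_) (take-++ʳ xs ys r)

    ≢[]⇒0<length : ∀ {xs : List A} → xs ≢ [] → 0 < length xs
    ≢[]⇒0<length {[]}    xs≢[] = ⊥-elim (xs≢[] refl)
    ≢[]⇒0<length {_ ∷ _} _     = s≤s z≤n

    ∈-tail : ∀ {x y : A} {xs} → x ∈ y ∷ xs → x ≢ y → x ∈ xs
    ∈-tail (here x≡y)   x≢y = ⊥-elim (x≢y x≡y)
    ∈-tail (there x∈xs) _   = x∈xs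

  last-occurrence-before : ∀ {A : Set} → DecidableEquality A → ∀ (w : ℕ → A) {a} → w 0 ≡ a →
                           ∀ j → 0 < j → ∃ λ i → i < j × w i ≡ a × (∀ k → i < k → k < j → w k ≢ a)
  last-occurrence-before _≟_ w w0≡a (suc zero) _ =
    0 , s≤s z≤n , w0≡a , λ { k 0<k (s≤s k≤0) → ⊥-elim (<⇒≱ 0<k k≤0) }
  last-occurrence-before _≟_ w {a} w0≡a (suc (suc j)) _
    with w (suc j) ≟ a | last-occurrence-before _≟_ w w0≡a (suc j) (s≤s z≤n)
  ... | yes wj≡a | _ =
    suc j , ≤-refl , wj≡a , λ k j<k k<j → ⊥-elim (<-irrefl refl (<-≤-trans j<k (≤-pred k<j)))
  ... | no  wj≢a | i , i<j , wi≡a , gap = i , m<n⇒m<1+n i<j , wi≡a , gap′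
    where
    gap′ : ∀ k → i < k → k < suc (suc j) → w k ≢ a
    gap′ k i<k k<j with m≤n⇒m<n∨m≡n (≤-pred k<j)
    ... | inj₁ k<1+j = gap k i<k k<1+j
    ... | inj₂ refl  = wj≢a

  ∃-interval : ∀ (f : ℕ → ℕ) {j} n → f 0 ≤ j → j < f n → ∃ λ k → k < n × f k ≤ j × j < f (suc k)
  ∃-interval f zero        f0≤j j<f0    = ⊥-elim (<⇒≱ j<f0 f0≤j)
  ∃-interval f {j} (suc n) f0≤j j<fn+1 with j <? f n
  ... | yes j<fn = let k , k<n , fk≤j , j<fk+1 = ∃-interval f n f0≤j j<fn in k , m<n⇒m<1+n k<n , fk≤j , j<fk+1
  ... | no  j≮fn = n , ≤-refl , ≮⇒≥ j≮fn , j<fn+1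

  module _ {σ : ℕ} where

    count : Fin σ → List (Fin σ) → ℕ
    count c xs = length (filter (Fin._≟ c) xs)

    count-++ : ∀ c xs ys → count c (xs ++ ys) ≡ count c xs + count c ys
    count-++ c xs ys = trans (cong length (filter-++ (Fin._≟ c) xs ys)) (length-++ (filter (Fin._≟ c) xs))

    count-∷ : ∀ x xs (b : Fin σ) → count b (x ∷ xs) ≡ δ x b + count b xs
    count-∷ x xs b with does (x Fin.≟ b)
    ... | true  = refl
    ... | false = refl

    countIn≡count-factor : ∀ w c i len → countIn w c i len ≡ count c (factor w i len)
    countIn≡count-factor w c i zero = refl
    countIn≡count-factor w c i (suc len) with does (w i Fin.≟ c)
    ... | true  = cong suc (countIn≡count-factor w c (suc i) len)
    ... | false = countIn≡count-factor w c (suc i) len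

    incidence : Morphism σ → (Fin σ → ℕ) → Fin σ → ℕ
    incidence φ p c = sum (λ b → p b * count c (φ b))

    count-apply : ∀ φ c xs → count c (apply φ xs) ≡ incidence φ (λ b → count b xs) c
    count-apply φ c []       = sym (sum-replicate-zero σ)
    count-apply φ c (x ∷ xs) = begin
      count c (φ x ++ apply φ xs)                 ≡⟨ count-++ c (φ x) (apply φ xs) ⟩
      count c (φ x) + count c (apply φ xs)        ≡⟨ cong₂ _+_ (sym (sum-δ* x k)) (count-apply φ c xs) ⟩
      sum (λ b → δ x b * k b) + sum (λ b → count b xs * k b)
        ≡⟨ sym (∑-distrib-+ (λ b → δ x b * k b) (λ b → count b xs * k b)) ⟩
      sum (λ b → δ x b * k b + count b xs * k b)  ≡⟨ sum-cong-≗ (λ b → sym (*-distribʳ-+ (k b) (δ x b) (count b xs))) ⟩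
      sum (λ b → (δ x b + count b xs) * k b)      ≡⟨ sum-cong-≗ (λ b → cong (_* k b) (sym (count-∷ x xs b))) ⟩
      incidence φ (λ b → count b (x ∷ xs)) c      ∎
      where
      open ≡-Reasoning
      k : Fin σ → ℕ
      k b = count c (φ b)

  -- The fixed point of a prolongable morphism

  module FixedPoint {σ : ℕ} (φ : Morphism σ) (a : Fin σ)
                    (nonerasing : Nonerasing φ) (prolongable : Prolongable φ a) where

    w : ℕ → Fin σ
    w = fixpt φ a

    iterate : ℕ → List (Fin σ)
    iterate n = iter φ n a

    length-apply : ∀ xs → length xs ≤ length (apply φ xs)
    length-apply []       = z≤n
    length-apply (x ∷ xs) = subst (suc (length xs) ≤_) (sym (length-++ (φ x)))
                                  (+-mono-≤ (nonerasing x) (length-apply xs))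

    iterate-suc : ∀ n → ∃ λ z → 0 < length z × iterate (suc n) ≡ iterate n ++ z
    iterate-suc zero = let s , s≢[] , φa≡a∷s = prolongable in
      s , ≢[]⇒0<length s≢[] , trans (++-identityʳ (φ a)) φa≡a∷s
    iterate-suc (suc n) with iterate-suc n
    ... | z , 0<|z| , eq = apply φ z , <-≤-trans 0<|z| (length-apply z) ,
                           trans (cong (apply φ) eq) (concatMap-++ φ (iterate n) z)

    iterate-prefix : ∀ {m n} → m ≤ n → ∃ λ z → iterate n ≡ iterate m ++ z
    iterate-prefix {m} {n} m≤n with m≤n⇒m<n∨m≡n m≤n
    ... | inj₂ refl = [] , sym (++-identityʳ (iterate m))
    iterate-prefix {m} {suc n} _ | inj₁ (s≤s m≤n) with iterate-prefix m≤n | iterate-suc n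
    ... | z , eq | z′ , _ , eq′ = z ++ z′ , trans eq′ (trans (cong (_++ z′) eq) (++-assoc (iterate m) z z′))

    n<length-iterate : ∀ n → n < length (iterate n)
    n<length-iterate zero    = s≤s z≤n
    n<length-iterate (suc n) with iterate-suc n
    ... | z , 0<|z| , eq = subst (suc n <_) (sym (trans (cong length eq) (length-++ (iterate n))))
                                 (≤-<-trans (n<length-iterate n) (m<m+n _ 0<|z|))

    nth-iterate : ∀ n k → k < length (iterate n) → nth a (iterate n) k ≡ w k
    nth-iterate n k k< with ≤-total k n
    ... | inj₁ k≤n = let z , eq = iterate-prefix k≤n in
                     trans (cong (λ xs → nth a xs k) eq) (nth-++ˡ a (iterate k) z (n<length-iterate k))
    ... | inj₂ n≤k = let z , eq = iterate-prefix n≤k in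
                     sym (trans (cong (λ xs → nth a xs k) eq) (nth-++ˡ a (iterate n) z k<))

    iterate≡prefix : ∀ n → iterate n ≡ prefix w (length (iterate n))
    iterate≡prefix n = ≡factor a w 0 (iterate n) (nth-iterate n)

    pos : ℕ → ℕ
    pos k = length (apply φ (prefix w k))

    apply-prefix : ∀ k → apply φ (prefix w k) ≡ prefix w (pos k)
    apply-prefix k = ++≡factor⇒≡factor a w 0 (apply φ (prefix w k)) (apply φ rest) (begin
      apply φ (prefix w k) ++ apply φ rest  ≡⟨ sym (concatMap-++ φ (prefix w k) rest) ⟩
      apply φ (prefix w k ++ rest)          ≡⟨ cong (apply φ) (sym split) ⟩
      iterate (suc k)                       ≡⟨ iterate≡prefix (suc k) ⟩
      prefix w (length (iterate (suc k)))   ∎)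
      where
      open ≡-Reasoning
      rest : List (Fin σ)
      rest = factor w k (length (iterate k) ∸ k)
      split : iterate k ≡ prefix w k ++ rest
      split = trans (iterate≡prefix k)
                    (trans (cong (prefix w) (sym (m+[n∸m]≡n (<⇒≤ (n<length-iterate k)))))
                           (factor-+ w 0 k _))

    apply-prefix-suc : ∀ k → apply φ (prefix w (suc k)) ≡ apply φ (prefix w k) ++ φ (w k)
    apply-prefix-suc k = begin
      apply φ (prefix w (suc k))               ≡⟨ cong (apply φ) (factor-snoc w 0 k) ⟩
      apply φ (prefix w k ++ [ w k ])          ≡⟨ concatMap-++ φ (prefix w k) [ w k ] ⟩
      apply φ (prefix w k) ++ (φ (w k) ++ [])  ≡⟨ cong (apply φ (prefix w k) ++_) (++-identityʳ (φ (w k))) ⟩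
      apply φ (prefix w k) ++ φ (w k)          ∎
      where open ≡-Reasoning

    pos-suc : ∀ k → pos (suc k) ≡ pos k + length (φ (w k))
    pos-suc k = trans (cong length (apply-prefix-suc k)) (length-++ (apply φ (prefix w k)))

    child-letter : ∀ k {r} → r < length (φ (w k)) → w (pos k + r) ≡ nth a (φ (w k)) r
    child-letter k {r} r< = begin
      w (pos k + r)                                        ≡⟨ sym (nth-factor a w 0 inside) ⟩
      nth a (prefix w (pos (suc k))) (pos k + r)           ≡⟨ cong (λ xs → nth a xs (pos k + r)) (sym (apply-prefix (suc k))) ⟩
      nth a (apply φ (prefix w (suc k))) (pos k + r)       ≡⟨ cong (λ xs → nth a xs (pos k + r)) (apply-prefix-suc k) ⟩
      nth a (apply φ (prefix w k) ++ φ (w k)) (pos k + r)  ≡⟨ nth-++ʳ a (apply φ (prefix w k)) (φ (w k)) r ⟩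
      nth a (φ (w k)) r                                    ∎
      where
      open ≡-Reasoning
      inside : pos k + r < pos (suc k)
      inside = subst (pos k + r <_) (sym (pos-suc k)) (+-monoʳ-< (pos k) r<)

    child-prefix : ∀ k {r} → r ≤ length (φ (w k)) →
                   prefix w (pos k + r) ≡ apply φ (prefix w k) ++ take r (φ (w k))
    child-prefix k {r} r≤ = begin
      prefix w (pos k + r)                                ≡⟨ sym (take-factor w 0 inside) ⟩
      take (pos k + r) (prefix w (pos (suc k)))           ≡⟨ cong (take (pos k + r)) (sym (apply-prefix (suc k))) ⟩
      take (pos k + r) (apply φ (prefix w (suc k)))       ≡⟨ cong (take (pos k + r)) (apply-prefix-suc k) ⟩
      take (pos k + r) (apply φ (prefix w k) ++ φ (w k))  ≡⟨ take-++ʳ (apply φ (prefix w k)) (φ (w k)) r ⟩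
      apply φ (prefix w k) ++ take r (φ (w k))            ∎
      where
      open ≡-Reasoning
      inside : pos k + r ≤ pos (suc k)
      inside = subst (pos k + r ≤_) (sym (pos-suc k)) (+-monoʳ-≤ (pos k) r≤)

    suc<pos-suc : ∀ k → suc k < pos (suc k)
    suc<pos-suc zero = let _ , s≢[] , φa≡a∷s = prolongable in
      subst (1 <_) (sym (trans (pos-suc 0) (cong length φa≡a∷s))) (s≤s (≢[]⇒0<length s≢[]))
    suc<pos-suc (suc k) = subst (suc (suc k) <_) (sym (pos-suc (suc k)))
                                (≤-<-trans (suc<pos-suc k) (m<m+n _ (nonerasing (w (suc k)))))

    parent : ∀ j → ∃ λ k → ∃ λ r → r < length (φ (w k)) × pos k + r ≡ j × (k ≡ 0 ⊎ k < j)
    parent j with ∃-interval pos (suc j) z≤n (<-trans (n<1+n j) (suc<pos-suc j))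
    ... | k , _ , pos-k≤j , j<pos-k+1 = k , j ∸ pos k , r< , m+[n∸m]≡n pos-k≤j , k≡0∨k<j k pos-k≤j
      where
      r< : j ∸ pos k < length (φ (w k))
      r< = +-cancelˡ-< (pos k) _ _ (subst₂ _<_ (sym (m+[n∸m]≡n pos-k≤j)) (pos-suc k) j<pos-k+1)
      k≡0∨k<j : ∀ k → pos k ≤ j → k ≡ 0 ⊎ k < j
      k≡0∨k<j zero    _        = inj₁ refl
      k≡0∨k<j (suc k) pos-k≤j = inj₂ (<-≤-trans (suc<pos-suc k) pos-k≤j)

  module _ {m : ℕ} .{{_ : NonZero m}} where

    %-+-cong : ∀ {a b c d} → a % m ≡ b % m → c % m ≡ d % m → (a + c) % m ≡ (b + d) % m
    %-+-cong {a} {b} {c} {d} a≡b c≡d = begin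
      (a + c) % m             ≡⟨ %-distribˡ-+ a c m ⟩
      (a % m + c % m) % m     ≡⟨ cong₂ (λ x y → (x + y) % m) a≡b c≡d ⟩
      (b % m + d % m) % m     ≡⟨ sym (%-distribˡ-+ b d m) ⟩
      (b + d) % m             ∎
      where open ≡-Reasoning

    %-*-cong : ∀ {a b c d} → a % m ≡ b % m → c % m ≡ d % m → (a * c) % m ≡ (b * d) % m
    %-*-cong {a} {b} {c} {d} a≡b c≡d = begin
      (a * c) % m             ≡⟨ %-distribˡ-* a c m ⟩
      (a % m * (c % m)) % m   ≡⟨ cong₂ (λ x y → (x * y) % m) a≡b c≡d ⟩
      (b % m * (d % m)) % m   ≡⟨ sym (%-distribˡ-* b d m) ⟩
      (b * d) % m             ∎
      where open ≡-Reasoning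

    sum-%-cong : ∀ {n} {f g : Fin n → ℕ} → (∀ i → f i % m ≡ g i % m) → sum f % m ≡ sum g % m
    sum-%-cong {zero}  _   = refl
    sum-%-cong {suc n} f≡g = %-+-cong (f≡g zero) (sum-%-cong (λ i → f≡g (suc i)))

-- Subgroups of ℤ^σ

module _ where

  open import Data.Integer using (_+_; _-_; _*_; -_)
  open import Data.Nat using (_%_; _/_)
  open Kronecker ℤₚ.+-*-semiring using (δ; δ-diag; δ-off; sum-*δ)
  open SemiringSum ℤₚ.+-*-semiring using (sum; sum-cong-≗)
  open CommutativeMonoidSum ℤₚ.*-1-commutativeMonoid using () renaming (sum to product)

  infix 4 _≡_mod_
  record _≡_mod_ (x y : ℤ) (m : ℕ) : Set where
    constructor congruent
    field m∣x-y : + m ∣ x - y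

  _≡_mod?_ : ∀ x y m → Dec (x ≡ y mod m)
  x ≡ y mod? m = Dec.map′ congruent _≡_mod_.m∣x-y (+ m ∣? x - y)

  module _ {m : ℕ} where

    mod-refl : ∀ {x} → x ≡ x mod m
    mod-refl {x} = congruent (divides (+ 0) (x-x≡0 x))
      where x-x≡0 : ∀ x → x - x ≡ + 0 * + m
            x-x≡0 = solve-∀

    mod-reflexive : ∀ {x y} → x ≡ y → x ≡ y mod m
    mod-reflexive refl = mod-refl

    mod-sym : ∀ {x y} → x ≡ y mod m → y ≡ x mod m
    mod-sym {x} {y} (congruent p) = congruent (subst (+ m ∣_) (regroup x y) (∣m⇒∣-m p))
      where regroup : ∀ x y → - (x - y) ≡ y - x
            regroup = solve-∀

    mod-trans : ∀ {x y z} → x ≡ y mod m → y ≡ z mod m → x ≡ z mod m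
    mod-trans {x} {y} {z} (congruent p) (congruent q) = congruent (subst (+ m ∣_) (regroup x y z) (∣m∣n⇒∣m+n p q))
      where regroup : ∀ x y z → (x - y) + (y - z) ≡ x - z
            regroup = solve-∀

    mod-+-cong : ∀ {x y u v} → x ≡ y mod m → u ≡ v mod m → x + u ≡ y + v mod m
    mod-+-cong {x} {y} {u} {v} (congruent p) (congruent q) =
      congruent (subst (+ m ∣_) (regroup x y u v) (∣m∣n⇒∣m+n p q))
      where regroup : ∀ x y u v → (x - y) + (u - v) ≡ (x + u) - (y + v)
            regroup = solve-∀

    mod-neg-cong : ∀ {x y} → x ≡ y mod m → - x ≡ - y mod m
    mod-neg-cong {x} {y} (congruent p) = congruent (subst (+ m ∣_) (regroup x y) (∣m⇒∣-m p))
      where regroup : ∀ x y → - (x - y) ≡ - x - - y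
            regroup = solve-∀

    mod-*-cong : ∀ {x y u v} → x ≡ y mod m → u ≡ v mod m → x * u ≡ y * v mod m
    mod-*-cong {x} {y} {u} {v} (congruent p) (congruent q) =
      congruent (subst (+ m ∣_) (regroup x y u v) (∣m∣n⇒∣m+n (∣m⇒∣m*n u p) (∣n⇒∣m*n y q)))
      where regroup : ∀ x y u v → (x - y) * u + y * (u - v) ≡ x * u - y * v
            regroup = solve-∀

    mod-quotient : ∀ {x y} → x ≡ y mod m → ∃ λ q → x ≡ y + q * + m
    mod-quotient {x} {y} (congruent (divides q x-y≡qm)) = q , (begin
      x            ≡⟨ regroup x y ⟩
      y + (x - y)  ≡⟨ cong (_+_ y) x-y≡qm ⟩
      y + q * + m  ∎)
      where open ≡-Reasoning
            regroup : ∀ x y → x ≡ y + (x - y)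
            regroup = solve-∀

    +n≡+[n%m] : ∀ n .{{_ : NonZero m}} → + n ≡ + (n % m) mod m
    +n≡+[n%m] n = congruent (divides (+ (n / m)) (begin
      + n - + (n % m)                          ≡⟨ cong (λ k → + k - + (n % m)) (m≡m%n+[m/n]*n n m) ⟩
      + (n % m ℕ.+ n / m ℕ.* m) - + (n % m)    ≡⟨ cong (_- + (n % m)) (trans (ℤₚ.pos-+ (n % m) _)
                                                                             (cong (_+_ (+ (n % m))) (ℤₚ.pos-* (n / m) m))) ⟩
      + (n % m) + + (n / m) * + m - + (n % m)  ≡⟨ cancel (+ (n % m)) (+ (n / m) * + m) ⟩
      + (n / m) * + m                          ∎))
      where open ≡-Reasoning
            cancel : ∀ r k → r + k - r ≡ k
            cancel = solve-∀

    -x≡[m∸1]*x : ∀ x .{{_ : NonZero m}} → - x ≡ + ℕ.pred m * x mod m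
    -x≡[m∸1]*x x = congruent (divides (- x) (begin
      - x - + ℕ.pred m * x      ≡⟨ regroup x (+ ℕ.pred m) ⟩
      - x * (+ 1 + + ℕ.pred m)  ≡⟨ cong (λ k → - x * + k) (ℕₚ.suc-pred m) ⟩
      - x * + m                 ∎))
      where open ≡-Reasoning
            regroup : ∀ x p → - x - p * x ≡ - x * (+ 1 + p)
            regroup = solve-∀

  odd⇒≢0 : ∀ {x} → x ≡ + 1 mod 2 → x ≢ + 0
  odd⇒≢0 (congruent 2∣-1) refl with ℕ∣.∣1⇒≡1 (∣⇒∣ᵤ 2∣-1)
  ... | ()

  product-odd : ∀ {n} (f : Fin n → ℤ) → (∀ i → f i ≡ + 1 mod 2) → product f ≡ + 1 mod 2
  product-odd {zero}  f _   = mod-refl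
  product-odd {suc n} f odd = mod-*-cong (odd zero) (product-odd (λ i → f (suc i)) (λ i → odd (suc i)))

  ∣product : ∀ {n} (f : Fin n → ℤ) i → f i ∣ product f
  ∣product {suc n} f zero    = ∣m⇒∣m*n (product (λ i → f (suc i))) ∣-refl
  ∣product {suc n} f (suc i) = ∣n⇒∣m*n (f zero) (∣product (λ i → f (suc i)) i)

  Span-mono : ∀ {σ} {P Q : (Fin σ → ℤ) → Set} → (∀ {v} → P v → Span Q v) → ∀ {v} → Span P v → Span Q v
  Span-mono P⊆Q (gen p)   = P⊆Q p
  Span-mono P⊆Q zer       = zer
  Span-mono P⊆Q (add s t) = add (Span-mono P⊆Q s) (Span-mono P⊆Q t)
  Span-mono P⊆Q (neg s)   = neg (Span-mono P⊆Q s)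
  Span-mono P⊆Q (ext s e) = ext (Span-mono P⊆Q s) e

  SpanMod : ∀ {σ} → ((Fin σ → ℤ) → Set) → ℕ → (Fin σ → ℤ) → Set
  SpanMod P m v = ∃ λ g → Span P g × (∀ c → g c ≡ v c mod m)

  SpanMod-mono : ∀ {σ} {P Q : (Fin σ → ℤ) → Set} {m} → (∀ {v} → P v → Span Q v) →
                 ∀ {v} → SpanMod P m v → SpanMod Q m v
  SpanMod-mono P⊆Q (g , g∈ , g≡v) = g , Span-mono P⊆Q g∈ , g≡v

  module _ {σ : ℕ} {P : (Fin σ → ℤ) → Set} where

    Span-sub : ∀ {u v} → Span P u → Span P v → Span P (λ c → u c - v c)
    Span-sub s t = add s (neg t)

    Span-scaleℕ : ∀ {u} → Span P u → ∀ n → Span P (λ c → + n * u c)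
    Span-scaleℕ {u} s zero    = ext zer (λ c → sym (ℤₚ.*-zeroˡ (u c)))
    Span-scaleℕ {u} s (suc n) = ext (add s (Span-scaleℕ s n)) (λ c → regroup (+ n) (u c))
      where regroup : ∀ n x → x + n * x ≡ (+ 1 + n) * x
            regroup = solve-∀

    Span-scale : ∀ {u} → Span P u → ∀ k → Span P (λ c → k * u c)
    Span-scale     s (+ n)    = Span-scaleℕ s n
    Span-scale {u} s -[1+ n ] = ext (neg (Span-scaleℕ s (suc n))) (λ c → ℤₚ.neg-distribˡ-* (+ suc n) (u c))

    Span-sum : ∀ {n} (u : Fin n → Fin σ → ℤ) → (∀ i → Span P (u i)) → Span P (λ c → sum (λ i → u i c))
    Span-sum {zero}  u _  = zer
    Span-sum {suc n} u u∈ = add (u∈ zero) (Span-sum (λ i → u (suc i)) (λ i → u∈ (suc i)))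

    Span-scaled-basis : ∀ K → (∀ c → Span P (λ c′ → K * δ c c′)) → (t : Fin σ → ℤ) → Span P (λ c → K * t c)
    Span-scaled-basis K Kδ∈ t =
      ext (Span-sum (λ c c′ → t c * (K * δ c c′)) (λ c → Span-scale (Kδ∈ c) (t c))) λ c′ → begin
        sum (λ c → t c * (K * δ c c′))  ≡⟨ sum-cong-≗ (λ c → regroup (t c) K (δ c c′)) ⟩
        sum (λ c → (K * t c) * δ c c′)  ≡⟨ sum-*δ (λ c → K * t c) c′ ⟩
        K * t c′                        ∎
      where open ≡-Reasoning
            regroup : ∀ x k d → x * (k * d) ≡ (k * x) * d
            regroup = solve-∀

    basis⇒GeneratesAll : (∀ c → Span P (δ c)) → GeneratesAll P
    basis⇒GeneratesAll δ∈ v =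
      ext (Span-scaled-basis (+ 1) (λ c → ext (δ∈ c) (λ c′ → sym (ℤₚ.*-identityˡ _))) v)
          (λ c → ℤₚ.*-identityˡ (v c))

    Span⇒SpanMod : ∀ {m v} → Span P v → SpanMod P m v
    Span⇒SpanMod s = _ , s , λ _ → mod-refl

    SpanMod⇒Span : ∀ {m v} → (∀ c → Span P (λ c′ → + m * δ c c′)) → SpanMod P m v → Span P v
    SpanMod⇒Span {m} {v} mδ∈ (g , g∈ , g≡v) = ext (add g∈ (Span-scaled-basis (+ m) mδ∈ q)) g+mq≡v
      where
      q : Fin σ → ℤ
      q c = proj₁ (mod-quotient (mod-sym (g≡v c)))
      g+mq≡v : ∀ c → g c + + m * q c ≡ v c
      g+mq≡v c = trans (cong (_+_ (g c)) (ℤₚ.*-comm (+ m) (q c))) (sym (proj₂ (mod-quotient (mod-sym (g≡v c)))))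

  Matrix : ℕ → Set
  Matrix σ = Fin σ → Fin σ → ℤ

  clear : ∀ {σ} → Fin σ → Matrix σ → Matrix σ
  clear j U i c = if does (i Fin.≟ j) then U i c else U j j * U i c - U i j * U j c

  eliminate : ∀ {σ} → List (Fin σ) → Matrix σ → Matrix σ
  eliminate []       U = U
  eliminate (j ∷ js) U = clear j (eliminate js U)

  record Reduced {σ} (P : (Fin σ → ℤ) → Set) (done : List (Fin σ)) (U : Matrix σ) : Set where
    field
      rows∈Span : ∀ i → Span P (U i)
      ≡δ-mod2   : ∀ i c → U i c ≡ δ i c mod 2
      cleared   : ∀ {i j} → j ∈ done → i ≢ j → U i j ≡ + 0

    diagonal-odd : ∀ i → U i i ≡ + 1 mod 2
    diagonal-odd i = subst (λ d → U i i ≡ d mod 2) (δ-diag i) (≡δ-mod2 i i)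

    off-diagonal-even : ∀ {i j} → i ≢ j → U i j ≡ + 0 mod 2
    off-diagonal-even {i} {j} i≢j = subst (λ d → U i j ≡ d mod 2) (δ-off i≢j) (≡δ-mod2 i j)

  module _ {σ : ℕ} {P : (Fin σ → ℤ) → Set} where

    clear-Reduced : ∀ {done U} j → Reduced P done U → Reduced P (j ∷ done) (clear j U)
    clear-Reduced {done} {U} j red =
      record { rows∈Span = rows∈Span′ ; ≡δ-mod2 = ≡δ-mod2′ ; cleared = cleared′ }
      where
      open Reduced red

      rows∈Span′ : ∀ i → Span P (clear j U i)
      rows∈Span′ i with i Fin.≟ j
      ... | yes _ = rows∈Span i
      ... | no _  = Span-sub (Span-scale (rows∈Span i) (U j j)) (Span-scale (rows∈Span j) (U i j))

      ≡δ-mod2′ : ∀ i c → clear j U i c ≡ δ i c mod 2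
      ≡δ-mod2′ i c with i Fin.≟ j
      ... | yes _  = ≡δ-mod2 i c
      ... | no i≢j = mod-trans
        (mod-+-cong (mod-*-cong (diagonal-odd j) (≡δ-mod2 i c))
                    (mod-neg-cong (mod-*-cong (off-diagonal-even i≢j) mod-refl)))
        (mod-reflexive (regroup (δ i c) (U j c)))
        where regroup : ∀ x y → + 1 * x - + 0 * y ≡ x
              regroup = solve-∀

      cleared′ : ∀ {i j′} → j′ ∈ j ∷ done → i ≢ j′ → clear j U i j′ ≡ + 0
      cleared′ {i} {j′} j′∈ i≢j′ with i Fin.≟ j | j′ Fin.≟ j
      ... | yes refl | yes refl = ⊥-elim (i≢j′ refl)
      ... | yes refl | no j′≢j  = cleared (∈-tail j′∈ j′≢j) i≢j′
      ... | no _     | yes refl = regroup (U j j) (U i j)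
        where regroup : ∀ x y → x * y - y * x ≡ + 0
              regroup = solve-∀
      ... | no _     | no j′≢j  = begin
        U j j * U i j′ - U i j * U j j′  ≡⟨ cong₂ (λ x y → U j j * x - U i j * y)
                                             (cleared (∈-tail j′∈ j′≢j) i≢j′)
                                             (cleared (∈-tail j′∈ j′≢j) (λ j≡j′ → j′≢j (sym j≡j′))) ⟩
        U j j * + 0 - U i j * + 0        ≡⟨ regroup (U j j) (U i j) ⟩
        + 0                              ∎
        where open ≡-Reasoning
              regroup : ∀ x y → x * + 0 - y * + 0 ≡ + 0
              regroup = solve-∀

    eliminate-Reduced : ∀ {U} js → Reduced P [] U → Reduced P js (eliminate js U)
    eliminate-Reduced []       red = red
    eliminate-Reduced (j ∷ js) red = clear-Reduced j (eliminate-Reduced js red)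

    full-rank : (∀ c → SpanMod P 2 (δ c)) → ∃ λ m → NonZero m × (∀ c → Span P (λ c′ → + m * δ c c′))
    full-rank δ-mod2 = ∣ D ∣ , ≢-nonZero (λ ∣D∣≡0 → D≢0 (ℤₚ.∣i∣≡0⇒i≡0 ∣D∣≡0)) , ∣D∣δ∈Span
      where
      U : Matrix σ
      U c = proj₁ (δ-mod2 c)

      U-Reduced : Reduced P [] U
      U-Reduced = record
        { rows∈Span = λ c → proj₁ (proj₂ (δ-mod2 c))
        ; ≡δ-mod2   = λ c → proj₂ (proj₂ (δ-mod2 c))
        ; cleared   = λ ()
        }

      V : Matrix σ
      V = eliminate (allFin σ) U

      V-Reduced : Reduced P (allFin σ) V
      V-Reduced = eliminate-Reduced (allFin σ) U-Reduced

      open Reduced V-Reduced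

      V-diagonal : ∀ i c → V i c ≡ V i i * δ i c
      V-diagonal i c with i Fin.≟ c
      ... | yes refl = sym (ℤₚ.*-identityʳ (V i i))
      ... | no i≢c   = trans (cleared (∈-allFin c) i≢c) (sym (ℤₚ.*-zeroʳ (V i i)))

      D : ℤ
      D = product (λ i → V i i)

      D≢0 : D ≢ + 0
      D≢0 = odd⇒≢0 (product-odd _ diagonal-odd)

      Dδ∈Span : ∀ c → Span P (λ c′ → D * δ c c′)
      Dδ∈Span c with ∣product (λ i → V i i) c
      ... | divides q D≡qV = ext (Span-scale (rows∈Span c) q) λ c′ → begin
        q * V c c′            ≡⟨ cong (_*_ q) (V-diagonal c c′) ⟩
        q * (V c c * δ c c′)  ≡⟨ sym (ℤₚ.*-assoc q (V c c) (δ c c′)) ⟩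
        (q * V c c) * δ c c′  ≡⟨ cong (_* δ c c′) (sym D≡qV) ⟩
        D * δ c c′            ∎
        where open ≡-Reasoning

      ∣D∣δ∈Span : ∀ c → Span P (λ c′ → + ∣ D ∣ * δ c c′)
      ∣D∣δ∈Span c with m∣∣m∣ {D}
      ... | divides k ∣D∣≡kD = ext (Span-scale (Dδ∈Span c) k)
        (λ c′ → trans (sym (ℤₚ.*-assoc k D (δ c c′))) (cong (_* δ c c′) (sym ∣D∣≡kD)))

    generatesAll? : (∀ m .{{_ : NonZero m}} v → Dec (SpanMod P m v)) → Dec (GeneratesAll P)
    generatesAll? spanMod? with Finₚ.all? (λ c → spanMod? 2 (δ c))
    ... | no ¬δ-mod2 = no (λ gen → ¬δ-mod2 (λ c → Span⇒SpanMod (gen (δ c))))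
    ... | yes δ-mod2 with full-rank δ-mod2
    ...   | m , m≢0 , mδ∈Span with Finₚ.all? (λ c → spanMod? m {{m≢0}} (δ c))
    ...     | yes δ-modm = yes (basis⇒GeneratesAll (λ c → SpanMod⇒Span mδ∈Span (δ-modm c)))
    ...     | no ¬δ-modm = no (λ gen → ¬δ-modm (λ c → Span⇒SpanMod (gen (δ c))))

  -- Deciding membership modulo m

  module Residues (m : ℕ) .{{_ : NonZero m}} where

    reduce : ∀ {n} → (Fin n → ℕ) → Vec ℕ n
    reduce f = tabulate (λ c → f c % m)

    residues : ∀ n → List (Vec ℕ n)
    residues zero    = [ [] ]
    residues (suc n) = concatMap (λ x → map (x ∷_) (residues n)) (upTo m)

    reduce∈residues : ∀ {n} (f : Fin n → ℕ) → reduce f ∈ residues n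
    reduce∈residues {zero}  f = here refl
    reduce∈residues {suc n} f = ∈-concatMap⁺ _ (lose (∈-upTo⁺ (m%n<n (f zero) m))
                                                   (∈-map⁺ (f zero % m ∷_) (reduce∈residues (λ c → f (suc c)))))

    reduce-cong : ∀ {n} {f g : Fin n → ℕ} → (∀ c → f c % m ≡ g c % m) → reduce f ≡ reduce g
    reduce-cong = tabulate-cong

    lookup-reduce-% : ∀ {n} (f : Fin n → ℕ) c → lookup (reduce f) c % m ≡ f c % m
    lookup-reduce-% f c = trans (cong (_% m) (lookup∘tabulate (λ c → f c % m) c)) (m%n%n≡m%n (f c) m)

    infix 4 _∼_
    record _∼_ {n} (v : Fin n → ℤ) (y : Vec ℕ n) : Set where
      constructor pointwise
      field at : ∀ c → v c ≡ + lookup y c mod m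
    open _∼_

    _∼?_ : ∀ {n} (v : Fin n → ℤ) y → Dec (v ∼ y)
    v ∼? y = Dec.map′ pointwise at (Finₚ.all? (λ c → v c ≡ + lookup y c mod? m))

    ∼-reduce : ∀ {n} {v : Fin n → ℤ} {f} → (∀ c → v c ≡ + f c mod m) → v ∼ reduce f
    ∼-reduce {f = f} v≡f = pointwise λ c →
      subst (λ r → _ ≡ + r mod m) (sym (lookup∘tabulate (λ c → f c % m) c)) (mod-trans (v≡f c) (+n≡+[n%m] (f c)))

    ∼-cong : ∀ {n} {u v : Fin n → ℤ} {y} → (∀ c → u c ≡ v c) → u ∼ y → v ∼ y
    ∼-cong u≡v u∼y = pointwise λ c → subst (λ x → x ≡ _ mod m) (u≡v c) (at u∼y c)

    infixl 6 _⊕_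
    _⊕_ : ∀ {n} → Vec ℕ n → Vec ℕ n → Vec ℕ n
    x ⊕ y = reduce (λ c → lookup x c ℕ.+ lookup y c)

    ⊕-assoc : ∀ {n} (x y z : Vec ℕ n) → (x ⊕ y) ⊕ z ≡ x ⊕ (y ⊕ z)
    ⊕-assoc x y z = reduce-cong λ c → begin
      (lookup (x ⊕ y) c ℕ.+ lookup z c) % m             ≡⟨ %-+-cong (lookup-reduce-% _ c) refl ⟩
      (lookup x c ℕ.+ lookup y c ℕ.+ lookup z c) % m    ≡⟨ cong (_% m) (ℕₚ.+-assoc (lookup x c) _ _) ⟩
      (lookup x c ℕ.+ (lookup y c ℕ.+ lookup z c)) % m  ≡⟨ %-+-cong {a = lookup x c} refl (sym (lookup-reduce-% _ c)) ⟩
      (lookup x c ℕ.+ lookup (y ⊕ z) c) % m             ∎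
      where open ≡-Reasoning

    ∼-⊕ : ∀ {n} {u v : Fin n → ℤ} {x y} → u ∼ x → v ∼ y → (λ c → u c + v c) ∼ x ⊕ y
    ∼-⊕ {u = u} {v} {x} {y} u∼x v∼y = ∼-reduce λ c →
      subst (λ s → u c + v c ≡ s mod m) (ℤₚ.pos-+ (lookup x c) (lookup y c)) (mod-+-cong (at u∼x c) (at v∼y c))

    module SpanModDecision {σ : ℕ} (P : (Fin σ → ℤ) → Set) (gens : List (Vec ℕ σ))
             (gens-sound    : ∀ {g} → g ∈ gens → ∃ λ v → Span P v × v ∼ g)
             (gens-complete : ∀ {v} → P v → ∃ λ g → g ∈ gens × v ∼ g) where

      origin : Vec ℕ σ
      origin = reduce (λ _ → 0)

      ∼-origin : (λ _ → + 0) ∼ origin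
      ∼-origin = ∼-reduce (λ _ → mod-refl)

      ⊕-gens⊆residues : ∀ x {y} → y ∈ map (x ⊕_) gens → y ∈ residues σ
      ⊕-gens⊆residues x y∈ with ∈-map⁻ (x ⊕_) y∈
      ... | _ , _ , refl = reduce∈residues _

      open Reachability (Vecₚ.≡-dec ℕₚ._≟_) (residues σ) origin (λ x → map (x ⊕_) gens) ⊕-gens⊆residues

      Reach⇒reduced : ∀ {x} → Reach x → ∃ λ f → x ≡ reduce f
      Reach⇒reduced start-reach = _ , refl
      Reach⇒reduced (step {s} _ y∈) with ∈-map⁻ (s ⊕_) y∈
      ... | _ , _ , refl = _ , refl

      ⊕-origin : ∀ {x} → Reach x → x ⊕ origin ≡ x
      ⊕-origin rx with Reach⇒reduced rx
      ... | f , refl = reduce-cong λ c →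
        trans (%-+-cong (lookup-reduce-% f c) (lookup-reduce-% _ c)) (cong (_% m) (ℕₚ.+-identityʳ (f c)))

      ⊕-Reach : ∀ {x y} → Reach x → Reach y → Reach (x ⊕ y)
      ⊕-Reach rx start-reach = subst Reach (sym (⊕-origin rx)) rx
      ⊕-Reach {x} rx (step {y} ry z∈) with ∈-map⁻ (y ⊕_) z∈
      ... | g , g∈ , refl = subst Reach (⊕-assoc x y g) (step (⊕-Reach rx ry) (∈-map⁺ _ g∈))

      scale : ℕ → Vec ℕ σ → Vec ℕ σ
      scale k y = reduce (λ c → k ℕ.* lookup y c)

      scale-Reach : ∀ {y} k → Reach y → Reach (scale k y)
      scale-Reach zero    ry = start-reach
      scale-Reach (suc k) ry = subst Reach (reduce-cong λ c → %-+-cong refl (lookup-reduce-% _ c))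
                                 (⊕-Reach ry (scale-Reach k ry))

      -- Negation is multiplication by m ∸ 1, so the additive closure of the generators is a group.
      ∼-neg : ∀ {v y} → v ∼ y → (λ c → - v c) ∼ scale (ℕ.pred m) y
      ∼-neg {v} {y} v∼y = ∼-reduce λ c →
        mod-trans (mod-neg-cong (at v∼y c))
                  (subst (λ s → - + lookup y c ≡ s mod m) (sym (ℤₚ.pos-* (ℕ.pred m) (lookup y c)))
                         (-x≡[m∸1]*x (+ lookup y c)))

      Reach⇒∼Span : ∀ {y} → Reach y → ∃ λ g → Span P g × g ∼ y
      Reach⇒∼Span start-reach = _ , zer , ∼-origin
      Reach⇒∼Span (step {x} rx y∈) with ∈-map⁻ (x ⊕_) y∈
      ... | g₀ , g₀∈ , refl with Reach⇒∼Span rx | gens-sound g₀∈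
      ...   | g , g∈ , g∼x | v , v∈ , v∼g₀ = _ , add g∈ v∈ , ∼-⊕ g∼x v∼g₀

      Span⇒∼Reach : ∀ {v} → Span P v → ∃ λ y → Reach y × v ∼ y
      Span⇒∼Reach (gen p) with gens-complete p
      ... | g , g∈ , v∼g = origin ⊕ g , step start-reach (∈-map⁺ _ g∈) ,
                           ∼-cong (λ c → ℤₚ.+-identityˡ _) (∼-⊕ ∼-origin v∼g)
      Span⇒∼Reach zer = origin , start-reach , ∼-origin
      Span⇒∼Reach (add s t) with Span⇒∼Reach s | Span⇒∼Reach t
      ... | x , rx , u∼x | y , ry , v∼y = x ⊕ y , ⊕-Reach rx ry , ∼-⊕ u∼x v∼y
      Span⇒∼Reach (neg s) with Span⇒∼Reach s
      ... | y , ry , v∼y = scale (ℕ.pred m) y , scale-Reach (ℕ.pred m) ry , ∼-neg v∼y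
      Span⇒∼Reach (ext s u≡v) with Span⇒∼Reach s
      ... | y , ry , u∼y = y , ry , ∼-cong u≡v u∼y

      spanMod? : ∀ v → Dec (SpanMod P m v)
      spanMod? v with any? (v ∼?_) reachable
      ... | yes found = let y , y∈ , v∼y = find found
                            g , g∈ , g∼y = Reach⇒∼Span (∈reachable⇒Reach y∈)
                        in yes (g , g∈ , λ c → mod-trans (at g∼y c) (mod-sym (at v∼y c)))
      ... | no ¬found = no λ (g , g∈ , g≡v) → let y , ry , g∼y = Span⇒∼Reach g∈ in
        ¬found (lose (Reach⇒∈reachable ry) (pointwise λ c → mod-trans (mod-sym (g≡v c)) (at g∼y c)))

-- Returns and the prefix automaton

module _ where

  open import Data.Integer using (_+_; _-_)
  open import Data.Nat using (_%_)

  module Returns {σ : ℕ} (φ : Morphism σ) (a : Fin σ)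
                 (nonerasing : Nonerasing φ) (prolongable : Prolongable φ a) where

    open FixedPoint φ a nonerasing prolongable

    prefixParikh : ℕ → Fin σ → ℕ
    prefixParikh j c = count c (prefix w j)

    PrefixVector : (Fin σ → ℤ) → Set
    PrefixVector v = ∃ λ j → w j ≡ a × (∀ c → v c ≡ + prefixParikh j c)

    Return : (Fin σ → ℤ) → Set
    Return = IsReturnParikh w a

    prefixParikh-+ : ∀ i len c → + prefixParikh (i ℕ.+ len) c ≡ + prefixParikh i c + parikh w i len c
    prefixParikh-+ i len c = begin
      + count c (prefix w (i ℕ.+ len))                      ≡⟨ cong (λ xs → + count c xs) (factor-+ w 0 i len) ⟩
      + count c (prefix w i ++ factor w i len)              ≡⟨ cong +_ (count-++ c (prefix w i) (factor w i len)) ⟩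
      + (prefixParikh i c ℕ.+ count c (factor w i len))     ≡⟨ cong (λ k → + (prefixParikh i c ℕ.+ k))
                                                                  (sym (countIn≡count-factor w c i len)) ⟩
      + (prefixParikh i c ℕ.+ countIn w c i len)            ≡⟨ ℤₚ.pos-+ (prefixParikh i c) _ ⟩
      + prefixParikh i c + parikh w i len c                 ∎
      where open ≡-Reasoning

    Return⊆SpanPrefixVector : ∀ {v} → Return v → Span PrefixVector v
    Return⊆SpanPrefixVector {v} (i , len , _ , wi≡a , wi+len≡a , _ , v≡) =
      ext (Span-sub (gen (i ℕ.+ len , wi+len≡a , λ _ → refl)) (gen (i , wi≡a , λ _ → refl))) λ c → begin
        + prefixParikh (i ℕ.+ len) c - + prefixParikh i c           ≡⟨ cong (_- + prefixParikh i c) (prefixParikh-+ i len c) ⟩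
        + prefixParikh i c + parikh w i len c - + prefixParikh i c  ≡⟨ cancel (+ prefixParikh i c) (parikh w i len c) ⟩
        parikh w i len c                                            ≡⟨ sym (v≡ c) ⟩
        v c                                                         ∎
      where open ≡-Reasoning
            cancel : ∀ x y → x + y - x ≡ y
            cancel = solve-∀

    prefixParikh∈SpanReturn : ∀ j → w j ≡ a → Span Return (λ c → + prefixParikh j c)
    prefixParikh∈SpanReturn j = bounded (suc j) j (ℕₚ.n<1+n j)
      where
      bounded : ∀ n j → j < n → w j ≡ a → Span Return (λ c → + prefixParikh j c)
      bounded (suc n) zero    _   _    = zer
      bounded (suc n) (suc j) j<n wj≡a with last-occurrence-before Fin._≟_ w refl (suc j) (s≤s z≤n)
      ... | i , i<j , wi≡a , gap =
        ext (add (bounded n i (ℕₚ.<-≤-trans i<j (ℕₚ.≤-pred j<n)) wi≡a) (gen return))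
            (λ c → trans (sym (prefixParikh-+ i len c)) (cong (λ k → + prefixParikh k c) i+len≡j))
        where
        len : ℕ
        len = suc j ℕ.∸ i
        i+len≡j : i ℕ.+ len ≡ suc j
        i+len≡j = ℕₚ.m+[n∸m]≡n (ℕₚ.<⇒≤ i<j)
        return : Return (parikh w i len)
        return = i , len , ℕₚ.m<n⇒0<n∸m i<j , wi≡a , subst (λ k → w k ≡ a) (sym i+len≡j) wj≡a ,
                 (λ k 0<k k<len → gap (i ℕ.+ k) (ℕₚ.m<m+n i 0<k)
                                      (subst (i ℕ.+ k <_) i+len≡j (ℕₚ.+-monoʳ-< i k<len))) ,
                 (λ _ → refl)

    PrefixVector⊆SpanReturn : ∀ {v} → PrefixVector v → Span Return v
    PrefixVector⊆SpanReturn (j , wj≡a , v≡) = ext (prefixParikh∈SpanReturn j wj≡a) (λ c → sym (v≡ c))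

  module PrefixAutomaton (m : ℕ) .{{_ : NonZero m}} {σ : ℕ} (φ : Morphism σ) (a : Fin σ)
                         (nonerasing : Nonerasing φ) (prolongable : Prolongable φ a) where

    open FixedPoint φ a nonerasing prolongable
    open Returns φ a nonerasing prolongable
    open Residues m

    State : Set
    State = Vec ℕ σ × Fin σ

    state : ℕ → State
    state j = reduce (prefixParikh j) , w j

    child : State → ℕ → State
    child (x , b) r = reduce (λ c → incidence φ (lookup x) c ℕ.+ count c (take r (φ b))) , nth a (φ b) r

    children : State → List State
    children s = map (child s) (upTo (length (φ (proj₂ s))))

    child-state : ∀ k {r} → r < length (φ (w k)) → child (state k) r ≡ state (pos k ℕ.+ r)
    child-state k {r} r< = cong₂ _,_ (reduce-cong λ c → begin
      (incidence φ (lookup (reduce (prefixParikh k))) c ℕ.+ count c (take r (φ (w k)))) % m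
        ≡⟨ %-+-cong (sum-%-cong (λ b → %-*-cong (lookup-reduce-% (prefixParikh k) b) refl)) refl ⟩
      (incidence φ (prefixParikh k) c ℕ.+ count c (take r (φ (w k)))) % m
        ≡⟨ cong (λ n → (n ℕ.+ count c (take r (φ (w k)))) % m) (sym (count-apply φ c (prefix w k))) ⟩
      (count c (apply φ (prefix w k)) ℕ.+ count c (take r (φ (w k)))) % m
        ≡⟨ cong (_% m) (sym (count-++ c (apply φ (prefix w k)) (take r (φ (w k))))) ⟩
      count c (apply φ (prefix w k) ++ take r (φ (w k))) % m
        ≡⟨ cong (λ xs → count c xs % m) (sym (child-prefix k (ℕₚ.<⇒≤ r<))) ⟩
      prefixParikh (pos k ℕ.+ r) c % m ∎)
      (sym (child-letter k r<))
      where open ≡-Reasoning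

    child∈children : ∀ k {r} → r < length (φ (w k)) → state (pos k ℕ.+ r) ∈ children (state k)
    child∈children k r< = subst (_∈ children (state k)) (child-state k r<) (∈-map⁺ (child (state k)) (∈-upTo⁺ r<))

    states : List State
    states = cartesianProduct (residues σ) (allFin σ)

    children⊆states : ∀ s {t} → t ∈ children s → t ∈ states
    children⊆states s t∈ with ∈-map⁻ (child s) t∈
    ... | _ , _ , refl = ∈-cartesianProduct⁺ (reduce∈residues _) (∈-allFin _)

    open Reachability (Productₚ.≡-dec (Vecₚ.≡-dec ℕₚ._≟_) Fin._≟_) states (state 0) children children⊆states

    Reach-state : ∀ j → Reach (state j)
    Reach-state j = bounded (suc j) j (ℕₚ.n<1+n j)
      where
      bounded : ∀ n j → j < n → Reach (state j)
      bounded (suc n) j j<n with parent j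
      ... | k , r , r< , refl , inj₁ refl = step start-reach (child∈children 0 r<)
      ... | k , r , r< , refl , inj₂ k<j  =
        step (bounded n k (ℕₚ.<-≤-trans k<j (ℕₚ.≤-pred j<n))) (child∈children k r<)

    Reach⇒state : ∀ {s} → Reach s → ∃ λ j → state j ≡ s
    Reach⇒state start-reach = 0 , refl
    Reach⇒state (step r t∈) with Reach⇒state r
    ... | k , refl with ∈-map⁻ (child (state k)) t∈
    ...   | r′ , r′∈ , refl = pos k ℕ.+ r′ , sym (child-state k (∈-upTo⁻ r′∈))

    generators : List (Vec ℕ σ)
    generators = map proj₁ (filter (λ s → proj₂ s Fin.≟ a) reachable)

    generators-sound : ∀ {g} → g ∈ generators → ∃ λ v → Span PrefixVector v × v ∼ g
    generators-sound g∈ with ∈-map∘filter⁻ proj₁ (λ s → proj₂ s Fin.≟ a) g∈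
    ... | s , s∈ , refl , s-at-a with Reach⇒state (∈reachable⇒Reach s∈)
    ...   | j , refl = (λ c → + prefixParikh j c) , gen (j , s-at-a , λ _ → refl) , ∼-reduce (λ _ → mod-refl)

    generators-complete : ∀ {v} → PrefixVector v → ∃ λ g → g ∈ generators × v ∼ g
    generators-complete (j , wj≡a , v≡) =
      reduce (prefixParikh j) ,
      ∈-map∘filter⁺ proj₁ (λ s → proj₂ s Fin.≟ a) (state j , Reach⇒∈reachable (Reach-state j) , refl , wj≡a) ,
      ∼-reduce (λ c → mod-reflexive (v≡ c))

    returns-spanMod? : ∀ v → Dec (SpanMod Return m v)
    returns-spanMod? v =
      Dec.map′ (SpanMod-mono PrefixVector⊆SpanReturn) (SpanMod-mono Return⊆SpanPrefixVector)
               (SpanModDecision.spanMod? PrefixVector generators generators-sound generators-complete v)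

proposition7 : (σ : ℕ) (φ : Morphism σ) (a : Fin σ) →
               Nonerasing φ → Prolongable φ a →
               Dec (GeneratesAll (IsReturnParikh (fixpt φ a) a))
proposition7 σ φ a nonerasing prolongable =
  generatesAll? (λ m → PrefixAutomaton.returns-spanMod? m φ a nonerasing prolongable)
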